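{- If $(F_{\mathbf{j}})$ and $(H_{\mathbf{k}})$ are polynomial (respectively strongly polynomial) sequences of simple graphs in $\mathbf{j}$ and $\mathbf{k}$ respectively, then the sequence $(H_{\mathbf{k}}[F_{\mathbf{j}}])$ of lexicographic products is polynomial (respectively strongly polynomial) in $(\mathbf{j},\mathbf{k})$.
   Context: Graphs are finite; $\mathrm{hom}(G,H)$ counts homomorphisms. $\mathbb{N}$ denotes the positive integers. A sequence $(H_{\mathbf{k}})$ indexed by all $\mathbf{k}\in\mathbb{N}^h$ is polynomial if for every graph $G$ there are finitely many polynomials $p_1(G;\mathbf{x}),\dots,p_m(G;\mathbf{x})$ such that for every $\mathbf{k}$, $\mathrm{hom}(G,H_{\mathbf{k}})=p_\ell(G;\mathbf{k})$ for some $\ell$; it is strongly polynomial if a single polynomial works for all $\mathbf{k}$. Here $\mathbf{j}\in\mathbb{N}^{\ell}$ and $\mathbf{k}\in\mathbb{N}^h$; each coordinate of $\mathbf{k}$ is either equal to some coordinate of $\mathbf{j}$ or independent of all coordinates of $\mathbf{j}$, and vice versa (e.g. possibly $\mathbf{j}=\mathbf{k}$); $(\mathbf{j},\mathbf{k})$ denotes the distinct variables among them. The lexicographic product $G_1[G_2]$ of simple graphs has vertex set $V(G_1)\times V(G_2)$, with $(u_1,u_2)\sim(v_1,v_2)$ iff $u_1v_1\in E(G_1)$, or $u_1=v_1$ and $u_2v_2\in E(G_2)$. -}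

module Defs where

open import Data.Bool using (Bool; true; false; _∧_; _∨_; not)
open import Data.Nat using (ℕ; zero; suc; _*_; _≤_)
open import Data.Fin using (Fin; remQuot)
open import Data.Fin.Properties using (_≟_)
open import Data.List using (List; []; _∷_; map; concatMap; allFin; filterᵇ; length)
open import Data.List.Membership.Propositional using (_∈_)
open import Data.Bool.ListAction using (all)
open import Data.Vec.Functional using (Vector) renaming (_∷_ to _∷ᶠ_)
open import Data.Product using (Σ; ∃; ∃-syntax; _×_; _,_; proj₁)
open import Data.Integer using (+_)
open import Data.Rational using (ℚ) renaming (_+_ to _+ℚ_; _*_ to _*ℚ_; _/_ to _/ℚ_)
open import Data.Sum using (_⊎_)
open import Function using (Injective; _∘_)
open import Relation.Binary.PropositionalEquality using (_≡_)
open import Relation.Nullary.Decidable using (⌊_⌋)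

-- Finite graphs: vertex set Fin V, adjacency given as a Bool-valued
-- relation (loops allowed; multiplicities are irrelevant for counting
-- homomorphisms into simple graphs).

record Graph : Set where
  field
    V   : ℕ
    adj : Fin V → Fin V → Bool
open Graph public

Symmetric : Graph → Set
Symmetric G = ∀ u v → adj G u v ≡ adj G v u

Simple : Graph → Set
Simple G = Symmetric G × (∀ u → adj G u u ≡ false)

allFuns : ∀ m n → List (Fin m → Fin n)
allFuns zero    n = (λ ()) ∷ []
allFuns (suc m) n = concatMap (λ f → map (λ i → i ∷ᶠ f) (allFin n)) (allFuns m n)

isHom : (G H : Graph) → (Fin (V G) → Fin (V H)) → Bool
isHom G H f =
  all (λ u → all (λ v → not (adj G u v) ∨ adj H (f u) (f v)) (allFin (V G))) (allFin (V G))

hom : Graph → Graph → ℕ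
hom G H = length (filterᵇ (isHom G H) (allFuns (V G) (V H)))

-- Lexicographic product G₁[G₂]: vertex set Fin (V₁ * V₂) ≅ V₁ × V₂ via
-- the bijection remQuot; (u₁,u₂) ~ (v₁,v₂) iff u₁v₁ ∈ E(G₁), or
-- u₁ = v₁ and u₂v₂ ∈ E(G₂).

lex : Graph → Graph → Graph
lex G₁ G₂ = record
  { V   = V G₁ * V G₂
  ; adj = λ a b → adjPair (remQuot (V G₂) a) (remQuot (V G₂) b)
  }
  where
  adjPair : Fin (V G₁) × Fin (V G₂) → Fin (V G₁) × Fin (V G₂) → Bool
  adjPair (u₁ , u₂) (v₁ , v₂) = adj G₁ u₁ v₁ ∨ (⌊ u₁ ≟ v₁ ⌋ ∧ adj G₂ u₂ v₂)

-- Positive integers and index vectors in ℕ^h (ℕ = positive integers).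

ℕ⁺ : Set
ℕ⁺ = Σ ℕ (λ n → 1 ≤ n)

Idx : ℕ → Set
Idx h = Fin h → ℕ⁺

Seq : ℕ → Set
Seq h = Idx h → Graph

data Poly (h : ℕ) : Set where
  con  : ℚ → Poly h
  var  : Fin h → Poly h
  _⊕_  : Poly h → Poly h → Poly h
  _⊗_  : Poly h → Poly h → Poly h

toℚ : ℕ → ℚ
toℚ n = (+ n) /ℚ 1

eval : ∀ {h} → Poly h → Idx h → ℚ
eval (con c) k = c
eval (var i) k = toℚ (proj₁ (k i))
eval (p ⊕ q) k = eval p k +ℚ eval q k
eval (p ⊗ q) k = eval p k *ℚ eval q k

IsPolynomial : ∀ {h} → Seq h → Set
IsPolynomial {h} H =
  ∀ (G : Graph) → Symmetric G →
    ∃[ ps ] (∀ (k : Idx h) → ∃[ p ] (p ∈ ps × toℚ (hom G (H k)) ≡ eval p k))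

IsStronglyPolynomial : ∀ {h} → Seq h → Set
IsStronglyPolynomial {h} H =
  ∀ (G : Graph) → Symmetric G →
    ∃[ p ] (∀ (k : Idx h) → toℚ (hom G (H k)) ≡ eval p k)

-- Variable sharing between j ∈ ℕ^ℓ and k ∈ ℕ^h: the distinct variables
-- (j,k) form Fin m; σ and τ say which variable each coordinate of j
-- (resp. k) is.

record Sharing (ℓ h m : ℕ) : Set where
  field
    σ     : Fin ℓ → Fin m
    τ     : Fin h → Fin m
    σ-inj : Injective _≡_ _≡_ σ
    τ-inj : Injective _≡_ _≡_ τ
    cover : ∀ (x : Fin m) → (∃[ a ] σ a ≡ x) ⊎ (∃[ b ] τ b ≡ x)
open Sharing public

lexSeq : ∀ {ℓ h m} → Sharing ℓ h m → Seq ℓ → Seq h → Seq m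
lexSeq s F H x = lex (H (x ∘ τ s)) (F (x ∘ σ s))

-- A homomorphism G → H[F] is a pair (κ , l): κ : V(G) → V(H) sends every edge of G either to an
-- edge of H or to a single vertex, and l is a homomorphism into F of the graph of the edges that
-- κ collapses (H is loopless, so a collapsed edge cannot also go to an edge of H). Hence
-- hom(G, H[F]) = Σ_κ [κ is a homomorphism on the uncollapsed edges] · hom(collapsed edges, F),
-- and the second factor only depends on the fibres of κ. Sorting the maps κ by their fibres
-- turns this into a sum of products hom(K, F) · inj(K′, H), where inj counts homomorphisms that
-- are injective on the fibres; by inclusion–exclusion every inj(K′, H) is an integer combination
-- of numbers hom(K″, H) for quotients K″ of K′. All these graphs are symmetric, so the counts are
-- (piecewise) polynomial in the parameters, and so is hom(G, H[F]).
--
-- Partitions are never enumerated: ∑ᴵ Φ q p g keeps q labels whose values must be distinct and p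
-- free labels, and ∑ᴵ-step resolves one free label at a time. Read forwards it sorts κ by its
-- fibres; read backwards it is the inclusion–exclusion.

module Submission where

open import Defs
open import Data.Nat using (ℕ)
open import Data.Product using (_×_)

open import Data.Bool using (Bool; true; false; _∧_; _∨_; not; T)
open import Data.Bool.ListAction using (all; any)
open import Data.Bool.Properties using (T-∧; T-∨)
open import Data.Empty using (⊥; ⊥-elim)
open import Data.Fin using (Fin; zero; suc; combine; _↑ˡ_; _↑ʳ_)
open import Data.Fin.Properties using (_≟_; remQuot-combine; suc-injective)
import Data.Integer as ℤ
import Data.Integer.Properties as ℤ
open import Data.List using (List; []; _∷_; map; concatMap; allFin; filterᵇ; length; tabulate; cartesianProductWith)
import Data.List.Properties as List
open import Data.List.Membership.Propositional using (_∈_)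
open import Data.List.Membership.Propositional.Properties using (∈-allFin; ∈-map⁺; ∈-cartesianProductWith⁺)
open import Data.List.Relation.Unary.All using (lookup)
open import Data.List.Relation.Unary.All.Properties using (all⁺; all⁻; tabulate⁺)
open import Data.List.Relation.Unary.Any using (here; satisfied)
open import Data.List.Relation.Unary.Any.Properties using (any⁺; any⁻) renaming (tabulate⁺ to any-tabulate⁺)
open import Data.Nat as ℕ using (zero; suc; _+_; _*_)
open import Data.Nat.ListAction using () renaming (sum to sumˡ)
open import Data.Nat.ListAction.Properties using () renaming (sum-++ to sumˡ-++)
open import Data.Nat.Properties using (+-*-semiring; +-assoc; +-identityʳ; *-assoc; *-comm; *-distribˡ-+; *-distribʳ-+)
open import Algebra.Properties.Semiring.Sum +-*-semiring
  using (sum-syntax; sum-cong-≗; ∑-distrib-+; ∑-comm; *-distribˡ-sum; sum-replicate-zero)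
open import Data.Product using (∃-syntax; _,_; proj₁; proj₂)
open import Data.Rational as ℚ using (ℚ; 1ℚ; -_; toℚᵘ; fromℚᵘ)
open import Data.Rational.Properties using (toℚᵘ-injective; toℚᵘ-fromℚᵘ; fromℚᵘ-cong; toℚᵘ-homo-+; toℚᵘ-homo-*)
open import Data.Rational.Solver using (module +-*-Solver)
open import Data.Rational.Unnormalised as ℚᵘ using (mkℚᵘ; *≡*)
import Data.Rational.Unnormalised.Properties as ℚᵘ
open import Data.Sum using (_⊎_; inj₁; inj₂; [_,_]′; fromInj₁; fromInj₂)
open import Data.Vec.Functional using (tail) renaming (_∷_ to _∷ᶠ_)
open import Function using (id; _∘_; _⇔_; mk⇔; Equivalence; Injective)
open import Relation.Binary.PropositionalEquality
open import Relation.Nullary.Decidable using (⌊_⌋; toWitness; fromWitness)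

open Equivalence using (to; from)

𝟙 : Bool → ℕ
𝟙 true  = 1
𝟙 false = 0

𝟙-∧ : ∀ a b → 𝟙 (a ∧ b) ≡ 𝟙 a * 𝟙 b
𝟙-∧ true  b = sym (+-identityʳ (𝟙 b))
𝟙-∧ false b = refl

𝟙*-cong : ∀ b {x y} → (T b → x ≡ y) → 𝟙 b * x ≡ 𝟙 b * y
𝟙*-cong true  x≡y = cong (_+ 0) (x≡y _)
𝟙*-cong false _   = refl

Extensional : ∀ {A B : Set} → ((A → B) → ℕ) → Set
Extensional φ = ∀ {f g} → f ≗ g → φ f ≡ φ g

∷-cong : ∀ {m} {A : Set} (x : A) {f g : Fin m → A} → f ≗ g → (x ∷ᶠ f) ≗ (x ∷ᶠ g)
∷-cong x f≗g zero    = refl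
∷-cong x f≗g (suc u) = f≗g u

∑ᴹ : ∀ m N → ((Fin m → Fin N) → ℕ) → ℕ
∑ᴹ zero    N φ = φ (λ ())
∑ᴹ (suc m) N φ = ∑ᴹ m N (λ f → ∑[ x < N ] φ (x ∷ᶠ f))

module _ {N : ℕ} where

  ∑ᴹ-cong : ∀ m {φ ψ : (Fin m → Fin N) → ℕ} → (∀ f → φ f ≡ ψ f) → ∑ᴹ m N φ ≡ ∑ᴹ m N ψ
  ∑ᴹ-cong zero    φ≗ψ = φ≗ψ _
  ∑ᴹ-cong (suc m) φ≗ψ = ∑ᴹ-cong m (λ f → sum-cong-≗ {N} (λ x → φ≗ψ _))

  ∑ᴹ-distrib-+ : ∀ m (φ ψ : (Fin m → Fin N) → ℕ) →
                 ∑ᴹ m N (λ f → φ f + ψ f) ≡ ∑ᴹ m N φ + ∑ᴹ m N ψ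
  ∑ᴹ-distrib-+ zero    φ ψ = refl
  ∑ᴹ-distrib-+ (suc m) φ ψ = trans (∑ᴹ-cong m (λ f → ∑-distrib-+ {N} _ _)) (∑ᴹ-distrib-+ m _ _)

  *-distribˡ-∑ᴹ : ∀ m c (φ : (Fin m → Fin N) → ℕ) → c * ∑ᴹ m N φ ≡ ∑ᴹ m N (λ f → c * φ f)
  *-distribˡ-∑ᴹ zero    c φ = refl
  *-distribˡ-∑ᴹ (suc m) c φ = trans (*-distribˡ-∑ᴹ m c _) (∑ᴹ-cong m (λ f → *-distribˡ-sum {N} c _))

  *-distribʳ-∑ᴹ : ∀ m c (φ : (Fin m → Fin N) → ℕ) → ∑ᴹ m N φ * c ≡ ∑ᴹ m N (λ f → φ f * c)
  *-distribʳ-∑ᴹ m c φ = trans (*-comm (∑ᴹ m N φ) c) (trans (*-distribˡ-∑ᴹ m c φ) (∑ᴹ-cong m (λ f → *-comm c (φ f))))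

  ∑-∑ᴹ-comm : ∀ a m (φ : Fin a → (Fin m → Fin N) → ℕ) →
              ∑[ i < a ] ∑ᴹ m N (φ i) ≡ ∑ᴹ m N (λ f → ∑[ i < a ] φ i f)
  ∑-∑ᴹ-comm a zero    φ = refl
  ∑-∑ᴹ-comm a (suc m) φ = trans (∑-∑ᴹ-comm a m _) (∑ᴹ-cong m (λ f → ∑-comm {a} {N} _))

∑-↑ : ∀ M K (ψ : Fin (M + K) → ℕ) → ∑[ z < M + K ] ψ z ≡ ∑[ i < M ] ψ (i ↑ˡ K) + ∑[ j < K ] ψ (M ↑ʳ j)
∑-↑ zero    K ψ = refl
∑-↑ (suc M) K ψ = trans (cong (ψ zero +_) (∑-↑ M K _)) (sym (+-assoc (ψ zero) _ _))

∑-combine : ∀ N M (ψ : Fin (N * M) → ℕ) → ∑[ z < N * M ] ψ z ≡ ∑[ a < N ] ∑[ b < M ] ψ (combine a b)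
∑-combine zero    M ψ = refl
∑-combine (suc N) M ψ = trans (∑-↑ M (N * M) ψ) (cong (∑[ b < M ] ψ (combine {suc N} zero b) +_) (∑-combine N M _))

combineMaps : ∀ {n N M} → (Fin n → Fin N) → (Fin n → Fin M) → Fin n → Fin (N * M)
combineMaps κ l u = combine (κ u) (l u)

∑ᴹ-combine : ∀ n N M (φ : (Fin n → Fin (N * M)) → ℕ) → Extensional φ →
             ∑ᴹ n (N * M) φ ≡ ∑ᴹ n N (λ κ → ∑ᴹ n M (λ l → φ (combineMaps κ l)))
∑ᴹ-combine zero    N M φ φ-ext = φ-ext (λ ())
∑ᴹ-combine (suc n) N M φ φ-ext = begin
  ∑ᴹ n (N * M) (λ f → ∑[ z < N * M ] φ (z ∷ᶠ f))
    ≡⟨ ∑ᴹ-combine n N M _ (λ f≗g → sum-cong-≗ {N * M} (λ z → φ-ext (∷-cong z f≗g))) ⟩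
  ∑ᴹ n N (λ κ → ∑ᴹ n M (λ l → ∑[ z < N * M ] φ (z ∷ᶠ combineMaps κ l)))
    ≡⟨ ∑ᴹ-cong n (λ κ → trans (∑ᴹ-cong n (λ l → ∑-combine N M _)) (sym (∑-∑ᴹ-comm N n _))) ⟩
  ∑ᴹ n N (λ κ → ∑[ a < N ] ∑ᴹ n M (λ l → ∑[ b < M ] φ (combine a b ∷ᶠ combineMaps κ l)))
    ≡⟨ ∑ᴹ-cong n (λ κ → sum-cong-≗ {N} (λ a → ∑ᴹ-cong n (λ l → sum-cong-≗ {M} (λ b →
         φ-ext (λ { zero → refl ; (suc u) → refl }))))) ⟩
  ∑ᴹ n N (λ κ → ∑[ a < N ] ∑ᴹ n M (λ l → ∑[ b < M ] φ (combineMaps (a ∷ᶠ κ) (b ∷ᶠ l)))) ∎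
  where open ≡-Reasoning

T-allFin : ∀ {n} {p : Fin n → Bool} → T (all p (allFin n)) ⇔ (∀ i → T (p i))
T-allFin {n} {p} = mk⇔ (λ t i → lookup (all⁺ p (allFin n) t) (∈-allFin i)) (λ f → all⁻ p (tabulate⁺ f))

T-anyFin : ∀ {n} {p : Fin n → Bool} → T (any p (allFin n)) ⇔ (∃[ i ] T (p i))
T-anyFin {n} {p} = mk⇔ (λ t → satisfied (any⁻ p (allFin n) t)) (λ (i , t) → any⁺ p (any-tabulate⁺ i t))

T-injective : ∀ {a b} → (T a → T b) → (T b → T a) → a ≡ b
T-injective {false} {false} _ _ = refl
T-injective {false} {true}  _ b⇒a = ⊥-elim (b⇒a _)
T-injective {true}  {false} a⇒b _ = ⊥-elim (a⇒b _)
T-injective {true}  {true}  _ _ = refl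

T-⇒ : ∀ {a b} → T (not a ∨ b) ⇔ (T a → T b)
T-⇒ {false} = mk⇔ (λ _ ()) _
T-⇒ {true}  = mk⇔ (λ t _ → t) (λ f → f _)

module _ {n : ℕ} where

  allPairs anyPair : (Fin n → Fin n → Bool) → Bool
  allPairs P = all (λ u → all (P u) (allFin n)) (allFin n)
  anyPair  P = any (λ u → any (P u) (allFin n)) (allFin n)

  T-allPairs : ∀ {P} → T (allPairs P) ⇔ (∀ u v → T (P u v))
  T-allPairs = mk⇔ (λ t u → to T-allFin (to T-allFin t u)) (λ f → from T-allFin (λ u → from T-allFin (f u)))

  T-anyPair : ∀ {P} → T (anyPair P) ⇔ (∃[ u ] ∃[ v ] T (P u v))
  T-anyPair = mk⇔ (λ t → let u , t′ = to T-anyFin t in u , to T-anyFin t′)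
                  (λ (u , v , t) → from T-anyFin (u , from T-anyFin (v , t)))

  allPairs-cong : ∀ {P Q} → (∀ u v → P u v ≡ Q u v) → allPairs P ≡ allPairs Q
  allPairs-cong P≡Q = T-injective (λ t → from T-allPairs (λ u v → subst T (P≡Q u v) (to T-allPairs t u v)))
                                  (λ t → from T-allPairs (λ u v → subst T (sym (P≡Q u v)) (to T-allPairs t u v)))

  allPairs-∧ : ∀ P Q → allPairs (λ u v → P u v ∧ Q u v) ≡ allPairs P ∧ allPairs Q
  allPairs-∧ P Q = T-injective
    (λ t → from T-∧ ( from T-allPairs (λ u v → proj₁ (to T-∧ (to T-allPairs t u v)))
                    , from T-allPairs (λ u v → proj₂ (to T-∧ (to T-allPairs t u v)))))
    (λ t → let tP , tQ = to T-∧ t in from T-allPairs (λ u v → from T-∧ (to T-allPairs tP u v , to T-allPairs tQ u v)))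

T-isHom : ∀ G H {f} → T (isHom G H f) ⇔ (∀ u v → T (adj G u v) → T (adj H (f u) (f v)))
T-isHom G H = mk⇔ (λ t u v → to T-⇒ (to T-allPairs t u v)) (λ f → from T-allPairs (λ u v → from T-⇒ (f u v)))

isHom-ext : ∀ G H {f g} → f ≗ g → isHom G H f ≡ isHom G H g
isHom-ext G H f≗g = allPairs-cong (λ u v → cong₂ (λ x y → not (adj G u v) ∨ adj H x y) (f≗g u) (f≗g v))

𝟙-isHom-ext : ∀ G H → Extensional (𝟙 ∘ isHom G H)
𝟙-isHom-ext G H = cong 𝟙 ∘ isHom-ext G H

length-filterᵇ : ∀ {A : Set} (p : A → Bool) xs → length (filterᵇ p xs) ≡ sumˡ (map (𝟙 ∘ p) xs)
length-filterᵇ p []       = refl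
length-filterᵇ p (x ∷ xs) with p x
... | true  = cong suc (length-filterᵇ p xs)
... | false = length-filterᵇ p xs

sumˡ-concatMap : ∀ {A B : Set} (φ : B → ℕ) (k : A → List B) xs →
                 sumˡ (map φ (concatMap k xs)) ≡ sumˡ (map (λ x → sumˡ (map φ (k x))) xs)
sumˡ-concatMap φ k []       = refl
sumˡ-concatMap φ k (x ∷ xs) = trans (cong sumˡ (List.map-++ φ (k x) _))
  (trans (sumˡ-++ (map φ (k x)) _) (cong (sumˡ (map φ (k x)) +_) (sumˡ-concatMap φ k xs)))

sumˡ-tabulate : ∀ N (φ : Fin N → ℕ) → sumˡ (tabulate φ) ≡ ∑[ x < N ] φ x
sumˡ-tabulate zero    φ = refl
sumˡ-tabulate (suc N) φ = cong (φ zero +_) (sumˡ-tabulate N (φ ∘ suc))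

sumˡ-allFuns : ∀ m N (φ : (Fin m → Fin N) → ℕ) → Extensional φ → sumˡ (map φ (allFuns m N)) ≡ ∑ᴹ m N φ
sumˡ-allFuns zero    N φ φ-ext = trans (+-identityʳ _) (φ-ext (λ ()))
sumˡ-allFuns (suc m) N φ φ-ext = begin
  sumˡ (map φ (concatMap (λ f → map (_∷ᶠ f) (allFin N)) (allFuns m N)))
    ≡⟨ sumˡ-concatMap φ _ (allFuns m N) ⟩
  sumˡ (map (λ f → sumˡ (map φ (map (_∷ᶠ f) (allFin N)))) (allFuns m N))
    ≡⟨ cong sumˡ (List.map-cong inner (allFuns m N)) ⟩
  sumˡ (map (λ f → ∑[ x < N ] φ (x ∷ᶠ f)) (allFuns m N))
    ≡⟨ sumˡ-allFuns m N _ (λ f≗g → sum-cong-≗ {N} (λ x → φ-ext (∷-cong x f≗g))) ⟩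
  ∑ᴹ (suc m) N φ ∎
  where
  open ≡-Reasoning
  inner : ∀ f → sumˡ (map φ (map (_∷ᶠ f) (allFin N))) ≡ ∑[ x < N ] φ (x ∷ᶠ f)
  inner f = trans (cong sumˡ (trans (sym (List.map-∘ (allFin N))) (List.map-tabulate id _)))
                  (sumˡ-tabulate N _)

hom-∑ᴹ : ∀ G H → hom G H ≡ ∑ᴹ (V G) (V H) (𝟙 ∘ isHom G H)
hom-∑ᴹ G H = trans (length-filterᵇ (isHom G H) (allFuns (V G) (V H)))
                   (sumˡ-allFuns (V G) (V H) _ (𝟙-isHom-ext G H))

⌊≟⌋-sym : ∀ {n} (x y : Fin n) → ⌊ x ≟ y ⌋ ≡ ⌊ y ≟ x ⌋
⌊≟⌋-sym x y = T-injective (fromWitness ∘ sym ∘ toWitness) (fromWitness ∘ sym ∘ toWitness)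

⌊≟⌋-injective : ∀ {m n} {a : Fin m → Fin n} → Injective _≡_ _≡_ a → ∀ x y → ⌊ a x ≟ a y ⌋ ≡ ⌊ x ≟ y ⌋
⌊≟⌋-injective a-inj x y = T-injective (fromWitness ∘ a-inj ∘ toWitness) (fromWitness ∘ cong _ ∘ toWitness)

restrict : (G : Graph) → (Fin (V G) → Fin (V G) → Bool) → Graph
restrict G P = record { V = V G ; adj = λ u v → adj G u v ∧ P u v }

insideFibres acrossFibres : (G : Graph) → ∀ {K} → (Fin (V G) → Fin K) → Graph
insideFibres G κ = restrict G (λ u v → ⌊ κ u ≟ κ v ⌋)
acrossFibres G κ = restrict G (λ u v → not ⌊ κ u ≟ κ v ⌋)

quotient : (G : Graph) → ∀ {p} → (Fin (V G) → Fin p) → Graph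
quotient G {p} h = record
  { V = p ; adj = λ i j → anyPair (λ u v → adj G u v ∧ (⌊ h u ≟ i ⌋ ∧ ⌊ h v ≟ j ⌋)) }

restrict-symmetric : ∀ G {P} → Symmetric G → (∀ u v → P u v ≡ P v u) → Symmetric (restrict G P)
restrict-symmetric G G-sym P-sym u v = cong₂ _∧_ (G-sym u v) (P-sym u v)

insideFibres-symmetric : ∀ G {K} (κ : Fin (V G) → Fin K) → Symmetric G → Symmetric (insideFibres G κ)
insideFibres-symmetric G κ G-sym = restrict-symmetric G G-sym (λ u v → ⌊≟⌋-sym (κ u) (κ v))

acrossFibres-symmetric : ∀ G {K} (κ : Fin (V G) → Fin K) → Symmetric G → Symmetric (acrossFibres G κ)
acrossFibres-symmetric G κ G-sym = restrict-symmetric G G-sym (λ u v → cong not (⌊≟⌋-sym (κ u) (κ v)))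

quotient-symmetric : ∀ G {p} (h : Fin (V G) → Fin p) → Symmetric G → Symmetric (quotient G h)
quotient-symmetric G h G-sym i j = T-injective (flip i j) (flip j i)
  where
  flip : ∀ i j → T (adj (quotient G h) i j) → T (adj (quotient G h) j i)
  flip i j t =
    let u , v , t′ = to T-anyPair t
        e , t″ = to T-∧ t′
        hu , hv = to (T-∧ {⌊ h u ≟ i ⌋}) t″
    in from T-anyPair (v , u , from T-∧ (subst T (G-sym u v) e , from (T-∧ {⌊ h v ≟ j ⌋}) (hv , hu)))

isHom-restrict-cong : ∀ G H {P Q} → (∀ u v → P u v ≡ Q u v) → ∀ f →
                      isHom (restrict G P) H f ≡ isHom (restrict G Q) H f
isHom-restrict-cong G H P≡Q f =
  allPairs-cong (λ u v → cong (λ b → not (adj G u v ∧ b) ∨ adj H (f u) (f v)) (P≡Q u v))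

hom-restrict-cong : ∀ G H {P Q} → (∀ u v → P u v ≡ Q u v) → hom (restrict G P) H ≡ hom (restrict G Q) H
hom-restrict-cong G H {P} {Q} P≡Q = begin
  hom (restrict G P) H                          ≡⟨ hom-∑ᴹ (restrict G P) H ⟩
  ∑ᴹ (V G) (V H) (𝟙 ∘ isHom (restrict G P) H)  ≡⟨ ∑ᴹ-cong (V G) (cong 𝟙 ∘ isHom-restrict-cong G H P≡Q) ⟩
  ∑ᴹ (V G) (V H) (𝟙 ∘ isHom (restrict G Q) H)  ≡⟨ hom-∑ᴹ (restrict G Q) H ⟨
  hom (restrict G Q) H                          ∎
  where open ≡-Reasoning

isHom-quotient : ∀ G H {p} (h : Fin (V G) → Fin p) b → isHom (quotient G h) H b ≡ isHom G H (b ∘ h)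
isHom-quotient G H h b = T-injective
  (λ t → from (T-isHom G H) (λ u v e → to (T-isHom (quotient G h) H) t (h u) (h v)
     (from T-anyPair (u , v , from T-∧ (e , from (T-∧ {⌊ h u ≟ h u ⌋}) (fromWitness refl , fromWitness refl))))))
  (λ t → from (T-isHom (quotient G h) H) (λ i j e →
     let u , v , t′ = to T-anyPair e
         e′ , t″ = to T-∧ t′
         hu , hv = to (T-∧ {⌊ h u ≟ i ⌋}) t″
     in subst₂ (λ x y → T (adj H (b x) (b y))) (toWitness hu) (toWitness hv) (to (T-isHom G H) t u v e′)))

-- Homomorphisms into a lexicographic product

Loopless : Graph → Set
Loopless H = ∀ u → adj H u u ≡ false

adj-lex : ∀ H F (a b : Fin (V H)) (x y : Fin (V F)) →
          adj (lex H F) (combine a x) (combine b y) ≡ adj H a b ∨ (⌊ a ≟ b ⌋ ∧ adj F x y)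
adj-lex H F a b x y = cong₂ adjPair (remQuot-combine a x) (remQuot-combine b y)
  where
  adjPair : Fin (V H) × Fin (V F) → Fin (V H) × Fin (V F) → Bool
  adjPair (a , x) (b , y) = adj H a b ∨ (⌊ a ≟ b ⌋ ∧ adj F x y)

-- An edge g of G either crosses fibres (e false) and must go to an edge h of H, or lies in a fibre
-- and must go to an edge f of F; since H is loopless, h is false inside a fibre.
lex-edge : ∀ g e h f → (T e → h ≡ false) →
           (not g ∨ (h ∨ (e ∧ f))) ≡ ((not (g ∧ not e) ∨ h) ∧ (not (g ∧ e) ∨ f))
lex-edge false e     h     f _    = refl
lex-edge true  true  h     f h≡ff rewrite h≡ff _ = refl
lex-edge true  false true  f _    = refl
lex-edge true  false false f _    = refl

isHom-lex : ∀ G H F → Loopless H → ∀ κ l →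
            isHom G (lex H F) (combineMaps κ l) ≡ isHom (acrossFibres G κ) H κ ∧ isHom (insideFibres G κ) F l
isHom-lex G H F H-loopless κ l = trans (allPairs-cong edge) (allPairs-∧ across inside)
  where
  across inside : Fin (V G) → Fin (V G) → Bool
  across u v = not (adj G u v ∧ not ⌊ κ u ≟ κ v ⌋) ∨ adj H (κ u) (κ v)
  inside u v = not (adj G u v ∧ ⌊ κ u ≟ κ v ⌋) ∨ adj F (l u) (l v)
  edge : ∀ u v → not (adj G u v) ∨ adj (lex H F) (combineMaps κ l u) (combineMaps κ l v) ≡ across u v ∧ inside u v
  edge u v = trans (cong (not (adj G u v) ∨_) (adj-lex H F (κ u) (κ v) (l u) (l v)))
    (lex-edge (adj G u v) _ _ _ (λ t → subst (λ w → adj H (κ u) w ≡ false) (toWitness t) (H-loopless (κ u))))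

weight : ∀ G H F → (Fin (V G) → Fin (V H)) → ℕ
weight G H F κ = 𝟙 (isHom (acrossFibres G κ) H κ) * hom (insideFibres G κ) F

weight-ext : ∀ G H F → Extensional (weight G H F)
weight-ext G H F {κ} {κ′} κ≗κ′ = cong₂ (λ a b → 𝟙 a * b)
  (trans (isHom-restrict-cong G H (λ u v → cong not (fibre u v)) κ) (isHom-ext (acrossFibres G κ′) H κ≗κ′))
  (hom-restrict-cong G F fibre)
  where
  fibre : ∀ u v → ⌊ κ u ≟ κ v ⌋ ≡ ⌊ κ′ u ≟ κ′ v ⌋
  fibre u v = cong₂ (λ x y → ⌊ x ≟ y ⌋) (κ≗κ′ u) (κ≗κ′ v)

hom-lex : ∀ G H F → Loopless H → hom G (lex H F) ≡ ∑ᴹ (V G) (V H) (weight G H F)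
hom-lex G H F H-loopless = begin
  hom G (lex H F)
    ≡⟨ hom-∑ᴹ G (lex H F) ⟩
  ∑ᴹ n (N * M) (𝟙 ∘ isHom G (lex H F))
    ≡⟨ ∑ᴹ-combine n N M _ (𝟙-isHom-ext G (lex H F)) ⟩
  ∑ᴹ n N (λ κ → ∑ᴹ n M (λ l → 𝟙 (isHom G (lex H F) (combineMaps κ l))))
    ≡⟨ ∑ᴹ-cong n (λ κ → ∑ᴹ-cong n (λ l → trans (cong 𝟙 (isHom-lex G H F H-loopless κ l)) (𝟙-∧ (across κ) _))) ⟩
  ∑ᴹ n N (λ κ → ∑ᴹ n M (λ l → 𝟙 (across κ) * 𝟙 (isHom (insideFibres G κ) F l)))
    ≡⟨ ∑ᴹ-cong n (λ κ → trans (cong (𝟙 (across κ) *_) (hom-∑ᴹ (insideFibres G κ) F))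
                              (*-distribˡ-∑ᴹ n (𝟙 (across κ)) _)) ⟨
  ∑ᴹ n N (weight G H F) ∎
  where
  open ≡-Reasoning
  n = V G
  N = V H
  M = V F
  across : (Fin n → Fin N) → Bool
  across κ = isHom (acrossFibres G κ) H κ

-- Sums over injective maps

_∈ᵇ_ : ∀ {q N} → Fin N → (Fin q → Fin N) → Bool
_∈ᵇ_ {zero}  x a = false
_∈ᵇ_ {suc q} x a = ⌊ x ≟ a zero ⌋ ∨ x ∈ᵇ tail a

injectiveᵇ : ∀ {q N} → (Fin q → Fin N) → Bool
injectiveᵇ {zero}  a = true
injectiveᵇ {suc q} a = not (a zero ∈ᵇ tail a) ∧ injectiveᵇ (tail a)

injectiveᵇ-∷ : ∀ {q N} (a : Fin (suc q) → Fin N) →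
               T (injectiveᵇ a) → T (not (a zero ∈ᵇ tail a)) × T (injectiveᵇ (tail a))
injectiveᵇ-∷ a = to (T-∧ {not (a zero ∈ᵇ tail a)})

not-T : ∀ {b} → T (not b) → T b → ⊥
not-T {false} _ ()

∈ᵇ-lookup : ∀ {q N} (a : Fin q → Fin N) i → T (a i ∈ᵇ a)
∈ᵇ-lookup a zero    = from (T-∨ {⌊ a zero ≟ a zero ⌋}) (inj₁ (fromWitness refl))
∈ᵇ-lookup a (suc i) = from (T-∨ {⌊ a (suc i) ≟ a zero ⌋}) (inj₂ (∈ᵇ-lookup (tail a) i))

injectiveᵇ-sound : ∀ {q N} (a : Fin q → Fin N) → T (injectiveᵇ a) → Injective _≡_ _≡_ a
injectiveᵇ-sound {suc q} a inj {zero}  {zero}  _     = refl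
injectiveᵇ-sound {suc q} a inj {zero}  {suc j} a₀≡aⱼ =
  ⊥-elim (not-T (proj₁ (injectiveᵇ-∷ a inj)) (subst (λ x → T (x ∈ᵇ tail a)) (sym a₀≡aⱼ) (∈ᵇ-lookup (tail a) j)))
injectiveᵇ-sound {suc q} a inj {suc i} {zero}  aᵢ≡a₀ =
  ⊥-elim (not-T (proj₁ (injectiveᵇ-∷ a inj)) (subst (λ x → T (x ∈ᵇ tail a)) aᵢ≡a₀ (∈ᵇ-lookup (tail a) i)))
injectiveᵇ-sound {suc q} a inj {suc i} {suc j} aᵢ≡aⱼ =
  cong suc (injectiveᵇ-sound (tail a) (proj₂ (injectiveᵇ-∷ a inj)) aᵢ≡aⱼ)

∑-δ : ∀ {N} (y : Fin N) (ψ : Fin N → ℕ) → ∑[ x < N ] (𝟙 ⌊ x ≟ y ⌋ * ψ x) ≡ ψ y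
∑-δ {suc N} zero    ψ = trans (cong₂ _+_ (+-identityʳ (ψ zero)) (sum-replicate-zero N)) (+-identityʳ (ψ zero))
∑-δ {suc N} (suc y) ψ = trans (sum-cong-≗ {N} (λ x → cong (λ b → 𝟙 b * ψ (suc x)) (⌊≟⌋-injective suc-injective x y)))
                               (∑-δ y (ψ ∘ suc))

𝟙-∨ : ∀ a b → (T a → T b → ⊥) → 𝟙 (a ∨ b) ≡ 𝟙 a + 𝟙 b
𝟙-∨ true  true  disjoint = ⊥-elim (disjoint _ _)
𝟙-∨ true  false _        = refl
𝟙-∨ false b     _        = refl

𝟙-not : ∀ b y → 𝟙 (not b) * y + 𝟙 b * y ≡ y
𝟙-not true  y = +-identityʳ y
𝟙-not false y = trans (+-identityʳ (y + 0)) (+-identityʳ y)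

∑-image : ∀ {q N} (a : Fin q → Fin N) → T (injectiveᵇ a) → (ψ : Fin N → ℕ) →
          ∑[ x < N ] (𝟙 (x ∈ᵇ a) * ψ x) ≡ ∑[ i < q ] ψ (a i)
∑-image {zero}  {N} a _   ψ = sum-replicate-zero N
∑-image {suc q} {N} a inj ψ = begin
  ∑[ x < N ] (𝟙 (⌊ x ≟ a zero ⌋ ∨ x ∈ᵇ tail a) * ψ x)
    ≡⟨ sum-cong-≗ {N} (λ x → trans (cong (_* ψ x) (𝟙-∨ _ _ (disjoint x))) (*-distribʳ-+ (ψ x) (𝟙 ⌊ x ≟ a zero ⌋) _)) ⟩
  ∑[ x < N ] (𝟙 ⌊ x ≟ a zero ⌋ * ψ x + 𝟙 (x ∈ᵇ tail a) * ψ x)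
    ≡⟨ ∑-distrib-+ (λ x → 𝟙 ⌊ x ≟ a zero ⌋ * ψ x) (λ x → 𝟙 (x ∈ᵇ tail a) * ψ x) ⟩
  ∑[ x < N ] (𝟙 ⌊ x ≟ a zero ⌋ * ψ x) + ∑[ x < N ] (𝟙 (x ∈ᵇ tail a) * ψ x)
    ≡⟨ cong₂ _+_ (∑-δ (a zero) ψ) (∑-image (tail a) (proj₂ (injectiveᵇ-∷ a inj)) ψ) ⟩
  ψ (a zero) + ∑[ i < q ] ψ (a (suc i)) ∎
  where
  open ≡-Reasoning
  disjoint : ∀ x → T ⌊ x ≟ a zero ⌋ → T (x ∈ᵇ tail a) → ⊥
  disjoint x x≡a₀ x∈ = not-T (proj₁ (injectiveᵇ-∷ a inj)) (subst (λ y → T (y ∈ᵇ tail a)) (toWitness x≡a₀) x∈)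

∑-split-image : ∀ {q N} (a : Fin q → Fin N) → T (injectiveᵇ a) → (ψ : Fin N → ℕ) →
                ∑[ x < N ] ψ x ≡ ∑[ x < N ] (𝟙 (not (x ∈ᵇ a)) * ψ x) + ∑[ i < q ] ψ (a i)
∑-split-image {q} {N} a inj ψ = begin
  ∑[ x < N ] ψ x
    ≡⟨ sum-cong-≗ {N} (λ x → 𝟙-not (x ∈ᵇ a) (ψ x)) ⟨
  ∑[ x < N ] (𝟙 (not (x ∈ᵇ a)) * ψ x + 𝟙 (x ∈ᵇ a) * ψ x)
    ≡⟨ ∑-distrib-+ (λ x → 𝟙 (not (x ∈ᵇ a)) * ψ x) (λ x → 𝟙 (x ∈ᵇ a) * ψ x) ⟩
  ∑[ x < N ] (𝟙 (not (x ∈ᵇ a)) * ψ x) + ∑[ x < N ] (𝟙 (x ∈ᵇ a) * ψ x)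
    ≡⟨ cong (∑[ x < N ] (𝟙 (not (x ∈ᵇ a)) * ψ x) +_) (∑-image a inj ψ) ⟩
  ∑[ x < N ] (𝟙 (not (x ∈ᵇ a)) * ψ x) + ∑[ i < q ] ψ (a i) ∎
  where open ≡-Reasoning

fresh : ∀ {q p} → Fin q ⊎ Fin (suc p) → Fin (suc q) ⊎ Fin p
fresh (inj₁ i)       = inj₁ (suc i)
fresh (inj₂ zero)    = inj₁ zero
fresh (inj₂ (suc j)) = inj₂ j

unfresh : ∀ {q p} → Fin (suc q) ⊎ Fin p → Fin q ⊎ Fin (suc p)
unfresh (inj₁ zero)    = inj₂ zero
unfresh (inj₁ (suc i)) = inj₁ i
unfresh (inj₂ j)       = inj₂ (suc j)

fresh-unfresh : ∀ {q p} (s : Fin (suc q) ⊎ Fin p) → fresh (unfresh s) ≡ s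
fresh-unfresh (inj₁ zero)    = refl
fresh-unfresh (inj₁ (suc i)) = refl
fresh-unfresh (inj₂ j)       = refl

merge : ∀ {q p} → Fin q → Fin q ⊎ Fin (suc p) → Fin q ⊎ Fin p
merge i (inj₁ i′)      = inj₁ i′
merge i (inj₂ zero)    = inj₁ i
merge i (inj₂ (suc j)) = inj₂ j

[,]-fresh : ∀ {A : Set} {q p} x (a : Fin q → A) (b : Fin p → A) s →
            [ x ∷ᶠ a , b ]′ (fresh s) ≡ [ a , x ∷ᶠ b ]′ s
[,]-fresh x a b (inj₁ i)       = refl
[,]-fresh x a b (inj₂ zero)    = refl
[,]-fresh x a b (inj₂ (suc j)) = refl

[,]-merge : ∀ {A : Set} {q p} i (a : Fin q → A) (b : Fin p → A) s →
            [ a , b ]′ (merge i s) ≡ [ a , a i ∷ᶠ b ]′ s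
[,]-merge i a b (inj₁ i′)      = refl
[,]-merge i a b (inj₂ zero)    = refl
[,]-merge i a b (inj₂ (suc j)) = refl

-- The sum of Φ over the maps [ a , b ]′ ∘ g with a injective: g labels the vertices, the q left
-- labels must get distinct values and the p right labels are free.
∑ᴵ : ∀ {n N} → ((Fin n → Fin N) → ℕ) → ∀ q p → (Fin n → Fin q ⊎ Fin p) → ℕ
∑ᴵ {N = N} Φ q p g = ∑ᴹ q N (λ a → 𝟙 (injectiveᵇ a) * ∑ᴹ p N (λ b → Φ ([ a , b ]′ ∘ g)))

module _ {n N} {Φ : (Fin n → Fin N) → ℕ} (Φ-ext : Extensional Φ) where

  ∑ᴵ-cong : ∀ q p {g g′ : Fin n → Fin q ⊎ Fin p} → g ≗ g′ → ∑ᴵ Φ q p g ≡ ∑ᴵ Φ q p g′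
  ∑ᴵ-cong q p g≗g′ =
    ∑ᴹ-cong q (λ a → cong (𝟙 (injectiveᵇ a) *_) (∑ᴹ-cong p (λ b → Φ-ext (cong [ a , b ]′ ∘ g≗g′))))

  ∑ᴵ-all : ∑ᴵ Φ 0 n inj₂ ≡ ∑ᴹ n N Φ
  ∑ᴵ-all = +-identityʳ _

  -- The value of the first free label is either new (it joins the distinct labels) or that of
  -- distinct label i.
  ∑ᴵ-step : ∀ q p g → ∑ᴵ Φ q (suc p) g ≡ ∑ᴵ Φ (suc q) p (fresh ∘ g) + ∑[ i < q ] ∑ᴵ Φ q p (merge i ∘ g)
  ∑ᴵ-step q p g = begin
    ∑ᴵ Φ q (suc p) g
      ≡⟨ ∑ᴹ-cong q split ⟩
    ∑ᴹ q N (λ a → newValue a + oldValue a)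
      ≡⟨ ∑ᴹ-distrib-+ q newValue oldValue ⟩
    ∑ᴹ q N newValue + ∑ᴹ q N oldValue
      ≡⟨ cong (∑ᴹ q N newValue +_) (∑-∑ᴹ-comm q q merged) ⟨
    ∑ᴵ Φ (suc q) p (fresh ∘ g) + ∑[ i < q ] ∑ᴵ Φ q p (merge i ∘ g) ∎
    where
    open ≡-Reasoning
    Ψ : (Fin q → Fin N) → Fin N → ℕ
    Ψ a x = ∑ᴹ p N (λ b → Φ ([ a , x ∷ᶠ b ]′ ∘ g))
    merged : Fin q → (Fin q → Fin N) → ℕ
    merged i a = 𝟙 (injectiveᵇ a) * ∑ᴹ p N (λ b → Φ ([ a , b ]′ ∘ merge i ∘ g))
    newValue oldValue : (Fin q → Fin N) → ℕ
    newValue a = ∑[ x < N ] (𝟙 (injectiveᵇ (x ∷ᶠ a)) * ∑ᴹ p N (λ b → Φ ([ x ∷ᶠ a , b ]′ ∘ fresh ∘ g)))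
    oldValue a = ∑[ i < q ] merged i a
    new : ∀ a x → 𝟙 (injectiveᵇ a) * (𝟙 (not (x ∈ᵇ a)) * Ψ a x) ≡
                  𝟙 (injectiveᵇ (x ∷ᶠ a)) * ∑ᴹ p N (λ b → Φ ([ x ∷ᶠ a , b ]′ ∘ fresh ∘ g))
    new a x = begin
      𝟙 (injectiveᵇ a) * (𝟙 (not (x ∈ᵇ a)) * Ψ a x)  ≡⟨ *-assoc (𝟙 (injectiveᵇ a)) _ _ ⟨
      𝟙 (injectiveᵇ a) * 𝟙 (not (x ∈ᵇ a)) * Ψ a x    ≡⟨ cong (_* Ψ a x) (*-comm (𝟙 (injectiveᵇ a)) _) ⟩
      𝟙 (not (x ∈ᵇ a)) * 𝟙 (injectiveᵇ a) * Ψ a x    ≡⟨ cong (_* Ψ a x) (𝟙-∧ (not (x ∈ᵇ a)) _) ⟨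
      𝟙 (injectiveᵇ (x ∷ᶠ a)) * Ψ a x
        ≡⟨ cong (𝟙 (injectiveᵇ (x ∷ᶠ a)) *_) (∑ᴹ-cong p (λ b → Φ-ext (sym ∘ [,]-fresh x a b ∘ g))) ⟩
      𝟙 (injectiveᵇ (x ∷ᶠ a)) * ∑ᴹ p N (λ b → Φ ([ x ∷ᶠ a , b ]′ ∘ fresh ∘ g)) ∎
    old : ∀ a i → 𝟙 (injectiveᵇ a) * Ψ a (a i) ≡ merged i a
    old a i = cong (𝟙 (injectiveᵇ a) *_) (∑ᴹ-cong p (λ b → Φ-ext (sym ∘ [,]-merge i a b ∘ g)))
    split : ∀ a → 𝟙 (injectiveᵇ a) * ∑ᴹ (suc p) N (λ b → Φ ([ a , b ]′ ∘ g)) ≡ newValue a + oldValue a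
    split a = begin
      ι * ∑ᴹ (suc p) N (λ b → Φ ([ a , b ]′ ∘ g))
        ≡⟨ cong (ι *_) (∑-∑ᴹ-comm N p (λ x b → Φ ([ a , x ∷ᶠ b ]′ ∘ g))) ⟨
      ι * ∑[ x < N ] Ψ a x
        ≡⟨ 𝟙*-cong (injectiveᵇ a) (λ inj → ∑-split-image a inj (Ψ a)) ⟩
      ι * (∑[ x < N ] (𝟙 (not (x ∈ᵇ a)) * Ψ a x) + ∑[ i < q ] Ψ a (a i))
        ≡⟨ *-distribˡ-+ ι (∑[ x < N ] (𝟙 (not (x ∈ᵇ a)) * Ψ a x)) _ ⟩
      ι * ∑[ x < N ] (𝟙 (not (x ∈ᵇ a)) * Ψ a x) + ι * ∑[ i < q ] Ψ a (a i)
        ≡⟨ cong₂ _+_ (trans (*-distribˡ-sum ι (λ x → 𝟙 (not (x ∈ᵇ a)) * Ψ a x)) (sum-cong-≗ {N} (new a)))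
                     (trans (*-distribˡ-sum ι (λ i → Ψ a (a i))) (sum-cong-≗ {q} (old a))) ⟩
      newValue a + oldValue a ∎
      where ι = 𝟙 (injectiveᵇ a)

∑ᴵ-quotient : ∀ K H {p} (h : Fin (V K) → Fin p) → ∑ᴵ (𝟙 ∘ isHom K H) 0 p (inj₂ ∘ h) ≡ hom (quotient K h) H
∑ᴵ-quotient K H {p} h = begin
  ∑ᴵ (𝟙 ∘ isHom K H) 0 p (inj₂ ∘ h)       ≡⟨ +-identityʳ _ ⟩
  ∑ᴹ p (V H) (λ b → 𝟙 (isHom K H (b ∘ h)))  ≡⟨ ∑ᴹ-cong p (λ b → cong 𝟙 (isHom-quotient K H h b)) ⟨
  ∑ᴹ p (V H) (𝟙 ∘ isHom (quotient K h) H)   ≡⟨ hom-∑ᴹ (quotient K h) H ⟨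
  hom (quotient K h) H                       ∎
  where open ≡-Reasoning

weight-injective : ∀ G H F {q} (c : Fin (V G) → Fin q) {a : Fin q → Fin (V H)} → Injective _≡_ _≡_ a →
                   weight G H F (a ∘ c) ≡ 𝟙 (isHom (acrossFibres G c) H (a ∘ c)) * hom (insideFibres G c) F
weight-injective G H F c {a} a-inj = cong₂ (λ x y → 𝟙 x * y)
  (isHom-restrict-cong G H (λ u v → cong not (fibre u v)) _) (hom-restrict-cong G F fibre)
  where
  fibre : ∀ u v → ⌊ a (c u) ≟ a (c v) ⌋ ≡ ⌊ c u ≟ c v ⌋
  fibre u v = ⌊≟⌋-injective a-inj (c u) (c v)

∑ᴵ-weight : ∀ G H F {q} (c : Fin (V G) → Fin q) →
            ∑ᴵ (weight G H F) q 0 (inj₁ ∘ c) ≡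
            ∑ᴵ (𝟙 ∘ isHom (acrossFibres G c) H) q 0 (inj₁ ∘ c) * hom (insideFibres G c) F
∑ᴵ-weight G H F {q} c = trans (∑ᴹ-cong q term) (sym (*-distribʳ-∑ᴹ q (hom (insideFibres G c) F) _))
  where
  term : ∀ a → 𝟙 (injectiveᵇ a) * weight G H F (a ∘ c) ≡
               𝟙 (injectiveᵇ a) * 𝟙 (isHom (acrossFibres G c) H (a ∘ c)) * hom (insideFibres G c) F
  term a = trans (𝟙*-cong (injectiveᵇ a) (weight-injective G H F c ∘ injectiveᵇ-sound a))
                 (sym (*-assoc (𝟙 (injectiveᵇ a)) _ _))

-- Counting functions with values in a subalgebra

fromℚᵘ-homo-+ : ∀ x y → fromℚᵘ (x ℚᵘ.+ y) ≡ fromℚᵘ x ℚ.+ fromℚᵘ y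
fromℚᵘ-homo-+ x y = toℚᵘ-injective (ℚᵘ.≃-trans (toℚᵘ-fromℚᵘ (x ℚᵘ.+ y))
  (ℚᵘ.≃-sym (ℚᵘ.≃-trans (toℚᵘ-homo-+ (fromℚᵘ x) (fromℚᵘ y)) (ℚᵘ.+-cong (toℚᵘ-fromℚᵘ x) (toℚᵘ-fromℚᵘ y)))))

fromℚᵘ-homo-* : ∀ x y → fromℚᵘ (x ℚᵘ.* y) ≡ fromℚᵘ x ℚ.* fromℚᵘ y
fromℚᵘ-homo-* x y = toℚᵘ-injective (ℚᵘ.≃-trans (toℚᵘ-fromℚᵘ (x ℚᵘ.* y))
  (ℚᵘ.≃-sym (ℚᵘ.≃-trans (toℚᵘ-homo-* (fromℚᵘ x) (fromℚᵘ y)) (ℚᵘ.*-cong (toℚᵘ-fromℚᵘ x) (toℚᵘ-fromℚᵘ y)))))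

ℕ→ℚᵘ : ℕ → ℚᵘ.ℚᵘ
ℕ→ℚᵘ n = mkℚᵘ (ℤ.+ n) 0

-- toℚ n is, by definition, fromℚᵘ (ℕ→ℚᵘ n).
toℚ-+ : ∀ a b → toℚ (a + b) ≡ toℚ a ℚ.+ toℚ b
toℚ-+ a b = trans (fromℚᵘ-cong {ℕ→ℚᵘ (a + b)} {ℕ→ℚᵘ a ℚᵘ.+ ℕ→ℚᵘ b} (*≡* (cong (ℤ._* ℤ.+ 1) numerator)))
                  (fromℚᵘ-homo-+ (ℕ→ℚᵘ a) (ℕ→ℚᵘ b))
  where
  numerator : ℤ.+ (a + b) ≡ ℤ.+ a ℤ.* ℤ.+ 1 ℤ.+ ℤ.+ b ℤ.* ℤ.+ 1
  numerator = trans (ℤ.pos-+ a b) (sym (cong₂ ℤ._+_ (ℤ.*-identityʳ (ℤ.+ a)) (ℤ.*-identityʳ (ℤ.+ b))))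

toℚ-* : ∀ a b → toℚ (a * b) ≡ toℚ a ℚ.* toℚ b
toℚ-* a b = trans (fromℚᵘ-cong {ℕ→ℚᵘ (a * b)} {ℕ→ℚᵘ a ℚᵘ.* ℕ→ℚᵘ b} (*≡* (cong (ℤ._* ℤ.+ 1) (ℤ.pos-* a b))))
                  (fromℚᵘ-homo-* (ℕ→ℚᵘ a) (ℕ→ℚᵘ b))

cancel : ∀ b c → (b ℚ.+ c) ℚ.+ (- 1ℚ) ℚ.* c ≡ b
cancel = solve 2 (λ b c → (b :+ c) :+ con (- 1ℚ) :* c := b) refl
  where open +-*-Solver

record Subalgebra (X : Set) : Set₁ where
  field
    Member   : (X → ℚ) → Set
    const    : ∀ c → Member (λ _ → c)
    +-closed : ∀ {f g} → Member f → Member g → Member (λ x → f x ℚ.+ g x)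
    *-closed : ∀ {f g} → Member f → Member g → Member (λ x → f x ℚ.* g x)
    ≗-closed : ∀ {f g} → f ≗ g → Member f → Member g

  Counts : (X → ℕ) → Set
  Counts f = Member (toℚ ∘ f)

  counts-≗ : ∀ {f g} → f ≗ g → Counts f → Counts g
  counts-≗ f≗g = ≗-closed (cong toℚ ∘ f≗g)

  counts-+ : ∀ f g → Counts f → Counts g → Counts (λ x → f x ℕ.+ g x)
  counts-+ f g cf cg = ≗-closed (λ x → sym (toℚ-+ (f x) (g x))) (+-closed cf cg)

  counts-* : ∀ f g → Counts f → Counts g → Counts (λ x → f x ℕ.* g x)
  counts-* f g cf cg = ≗-closed (λ x → sym (toℚ-* (f x) (g x))) (*-closed cf cg)

  counts-∑ : ∀ q (f : Fin q → X → ℕ) → (∀ i → Counts (f i)) → Counts (λ x → ∑[ i < q ] f i x)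
  counts-∑ zero    f _  = const (toℚ 0)
  counts-∑ (suc q) f cf = counts-+ (f zero) _ (cf zero) (counts-∑ q (f ∘ suc) (cf ∘ suc))

  counts-cancelʳ : ∀ {f} g h → (∀ x → f x ≡ g x ℕ.+ h x) → Counts f → Counts h → Counts g
  counts-cancelʳ {f} g h f≡g+h cf ch = ≗-closed difference (+-closed cf (*-closed (const (- 1ℚ)) ch))
    where
    difference : ∀ x → toℚ (f x) ℚ.+ (- 1ℚ) ℚ.* toℚ (h x) ≡ toℚ (g x)
    difference x = trans (cong (λ y → toℚ y ℚ.+ (- 1ℚ) ℚ.* toℚ (h x)) (f≡g+h x))
      (trans (cong (ℚ._+ (- 1ℚ) ℚ.* toℚ (h x)) (toℚ-+ (g x) (h x))) (cancel (toℚ (g x)) (toℚ (h x))))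

inj₁-fromInj₁ : ∀ {A : Set} (s : A ⊎ Fin 0) → s ≡ inj₁ (fromInj₁ (λ ()) s)
inj₁-fromInj₁ (inj₁ a) = refl

inj₂-fromInj₂ : ∀ {B : Set} (s : Fin 0 ⊎ B) → s ≡ inj₂ (fromInj₂ (λ ()) s)
inj₂-fromInj₂ (inj₂ b) = refl

module _ {X : Set} (A : Subalgebra X) (H F : X → Graph) (H-loopless : ∀ x → Loopless (H x))
         (homs-H : ∀ K → Symmetric K → Subalgebra.Counts A (λ x → hom K (H x)))
         (homs-F : ∀ K → Symmetric K → Subalgebra.Counts A (λ x → hom K (F x))) where
  open Subalgebra A

  injHoms : ∀ K q p → (Fin (V K) → Fin q ⊎ Fin p) → X → ℕ
  injHoms K q p h x = ∑ᴵ (𝟙 ∘ isHom K (H x)) q p h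

  weights : ∀ G q p → (Fin (V G) → Fin q ⊎ Fin p) → X → ℕ
  weights G q p g x = ∑ᴵ (weight G (H x) (F x)) q p g

  injHoms-counts : ∀ K → Symmetric K → ∀ q p h → Counts (injHoms K q p h)
  injHoms-counts K K-sym zero p h =
    counts-≗ (λ x → sym (trans (∑ᴵ-cong (𝟙-isHom-ext K (H x)) 0 p (inj₂-fromInj₂ ∘ h)) (∑ᴵ-quotient K (H x) h′)))
             (homs-H (quotient K h′) (quotient-symmetric K h′ K-sym))
    where h′ = fromInj₂ (λ ()) ∘ h
  injHoms-counts K K-sym (suc q) p h =
    counts-cancelʳ (injHoms K (suc q) p h) merged step
      (injHoms-counts K K-sym q (suc p) h′)
      (counts-∑ q (λ i → injHoms K q p (merge i ∘ h′)) (λ i → injHoms-counts K K-sym q p (merge i ∘ h′)))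
    where
    h′ = unfresh ∘ h
    merged : X → ℕ
    merged x = ∑[ i < q ] injHoms K q p (merge i ∘ h′) x
    step : ∀ x → injHoms K q (suc p) h′ x ≡ injHoms K (suc q) p h x + merged x
    step x = trans (∑ᴵ-step (𝟙-isHom-ext K (H x)) q p h′)
                   (cong (_+ merged x) (∑ᴵ-cong (𝟙-isHom-ext K (H x)) (suc q) p (fresh-unfresh ∘ h)))

  weights-counts : ∀ G → Symmetric G → ∀ p q g → Counts (weights G q p g)
  weights-counts G G-sym zero q g =
    counts-≗ (λ x → sym (trans (∑ᴵ-cong (weight-ext G (H x) (F x)) q 0 (inj₁-fromInj₁ ∘ g))
                               (∑ᴵ-weight G (H x) (F x) c)))
      (counts-* (injHoms (acrossFibres G c) q 0 (inj₁ ∘ c)) (λ x → hom (insideFibres G c) (F x))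
        (injHoms-counts (acrossFibres G c) (acrossFibres-symmetric G c G-sym) q 0 (inj₁ ∘ c))
        (homs-F (insideFibres G c) (insideFibres-symmetric G c G-sym)))
    where c = fromInj₁ (λ ()) ∘ g
  weights-counts G G-sym (suc p) q g =
    counts-≗ (λ x → sym (∑ᴵ-step (weight-ext G (H x) (F x)) q p g))
      (counts-+ (weights G (suc q) p (fresh ∘ g)) (λ x → ∑[ i < q ] weights G q p (merge i ∘ g) x)
        (weights-counts G G-sym p (suc q) (fresh ∘ g))
        (counts-∑ q (λ i → weights G q p (merge i ∘ g)) (λ i → weights-counts G G-sym p q (merge i ∘ g))))

  lex-counts : ∀ G → Symmetric G → Counts (λ x → hom G (lex (H x) (F x)))
  lex-counts G G-sym =
    counts-≗ (λ x → sym (trans (hom-lex G (H x) (F x) (H-loopless x)) (sym (∑ᴵ-all (weight-ext G (H x) (F x))))))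
      (weights-counts G G-sym (V G) 0 inj₂)

rename : ∀ {h m} → (Fin h → Fin m) → Poly h → Poly m
rename τ (con c) = con c
rename τ (var i) = var (τ i)
rename τ (p ⊕ q) = rename τ p ⊕ rename τ q
rename τ (p ⊗ q) = rename τ p ⊗ rename τ q

eval-rename : ∀ {h m} (τ : Fin h → Fin m) p (x : Idx m) → eval (rename τ p) x ≡ eval p (x ∘ τ)
eval-rename τ (con c) x = refl
eval-rename τ (var i) x = refl
eval-rename τ (p ⊕ q) x = cong₂ ℚ._+_ (eval-rename τ p x) (eval-rename τ q x)
eval-rename τ (p ⊗ q) x = cong₂ ℚ._*_ (eval-rename τ p x) (eval-rename τ q x)

polynomialFunctions : ∀ m → Subalgebra (Idx m)
polynomialFunctions m = record
  { Member   = λ f → ∃[ p ] (∀ x → f x ≡ eval p x)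
  ; const    = λ c → con c , λ _ → refl
  ; +-closed = λ (p , f≡p) (q , g≡q) → p ⊕ q , λ x → cong₂ ℚ._+_ (f≡p x) (g≡q x)
  ; *-closed = λ (p , f≡p) (q , g≡q) → p ⊗ q , λ x → cong₂ ℚ._*_ (f≡p x) (g≡q x)
  ; ≗-closed = λ f≗g (p , f≡p) → p , λ x → trans (sym (f≗g x)) (f≡p x)
  }

piecewisePolynomialFunctions : ∀ m → Subalgebra (Idx m)
piecewisePolynomialFunctions m = record
  { Member   = λ f → ∃[ ps ] (∀ x → ∃[ p ] (p ∈ ps × f x ≡ eval p x))
  ; const    = λ c → con c ∷ [] , λ _ → con c , here refl , refl
  ; +-closed = λ (ps , f∈) (qs , g∈) → cartesianProductWith _⊕_ ps qs , λ x →
      let p , p∈ , f≡p = f∈ x ; q , q∈ , g≡q = g∈ x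
      in p ⊕ q , ∈-cartesianProductWith⁺ _⊕_ p∈ q∈ , cong₂ ℚ._+_ f≡p g≡q
  ; *-closed = λ (ps , f∈) (qs , g∈) → cartesianProductWith _⊗_ ps qs , λ x →
      let p , p∈ , f≡p = f∈ x ; q , q∈ , g≡q = g∈ x
      in p ⊗ q , ∈-cartesianProductWith⁺ _⊗_ p∈ q∈ , cong₂ ℚ._*_ f≡p g≡q
  ; ≗-closed = λ f≗g (ps , f∈) → ps , λ x → let p , p∈ , f≡p = f∈ x in p , p∈ , trans (sym (f≗g x)) f≡p
  }

module _ {h m} (τ : Fin h → Fin m) (S : Seq h) where

  polynomial-rename : IsStronglyPolynomial S →
    ∀ G → Symmetric G → Subalgebra.Counts (polynomialFunctions m) (λ x → hom G (S (x ∘ τ)))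
  polynomial-rename S-poly G G-sym =
    let p , hom≡p = S-poly G G-sym in rename τ p , λ x → trans (hom≡p (x ∘ τ)) (sym (eval-rename τ p x))

  piecewisePolynomial-rename : IsPolynomial S →
    ∀ G → Symmetric G → Subalgebra.Counts (piecewisePolynomialFunctions m) (λ x → hom G (S (x ∘ τ)))
  piecewisePolynomial-rename S-poly G G-sym =
    let ps , hom∈ps = S-poly G G-sym
    in map (rename τ) ps , λ x → let p , p∈ps , hom≡p = hom∈ps (x ∘ τ)
                                 in rename τ p , ∈-map⁺ (rename τ) p∈ps , trans hom≡p (sym (eval-rename τ p x))

proposition3p7 : ∀ {ℓ h m : ℕ} (s : Sharing ℓ h m) (F : Seq ℓ) (H : Seq h) →
    (∀ j → Simple (F j)) → (∀ k → Simple (H k)) →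
    ((IsPolynomial F → IsPolynomial H → IsPolynomial (lexSeq s F H))
     × (IsStronglyPolynomial F → IsStronglyPolynomial H → IsStronglyPolynomial (lexSeq s F H)))
proposition3p7 {m = m} s F H _ H-simple =
  (λ F-poly H-poly → lex-counts (piecewisePolynomialFunctions m) H′ F′ H′-loopless
                       (piecewisePolynomial-rename (τ s) H H-poly) (piecewisePolynomial-rename (σ s) F F-poly)) ,
  (λ F-poly H-poly → lex-counts (polynomialFunctions m) H′ F′ H′-loopless
                       (polynomial-rename (τ s) H H-poly) (polynomial-rename (σ s) F F-poly))
  where
  H′ = λ x → H (x ∘ τ s)
  F′ = λ x → F (x ∘ σ s)
  H′-loopless : ∀ x → Loopless (H′ x)
  H′-loopless x = proj₂ (H-simple (x ∘ τ s))
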